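{- Let $p$ be a prime, $m\ge1$, $q=p^m$, and for $i,j\in\mathbb{F}_p$ let $T_{ij}=|\{x\in\mathbb{F}_q^{*}: tr(x)=i,\ tr(x^{ -1})=j\}|$. Then $$T_{10}=\frac qp-\sum_{s=1}^{p-1}T_{1s},\qquad T_{00}=(p-1)\sum_{s=1}^{p-1}T_{1s}+\frac{2q}{p}-q-1.$$
   Context: $\mathbb{F}_q$ is the finite field with $q=p^m$ elements and $tr(\gamma)=\gamma+\gamma^p+\cdots+\gamma^{p^{m-1}}\in\mathbb{F}_p$ is the absolute trace; elements $s$ of $\mathbb{F}_p$ are identified with integers $0,\dots,p-1$. -}

module Defs where

open import Level using (Level; _⊔_) renaming (suc to lsuc)
open import Algebra.Bundles using (CommutativeRing)
open import Data.Nat using (ℕ; zero; suc; _^_)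
open import Data.Fin using (Fin)
open import Data.List using (List; length; filter; allFin)
open import Data.Product using (∃; _×_)
open import Relation.Nullary using (¬_; ¬?)
open import Relation.Nullary.Decidable using (_×-dec_)
open import Relation.Binary.Definitions using (Decidable)
open import Relation.Binary.PropositionalEquality using (_≡_)

record FiniteField (c ℓ : Level) (q : ℕ) : Set (lsuc (c ⊔ ℓ)) where
  field
    commRing : CommutativeRing c ℓ
  open CommutativeRing commRing public
  field
    _≟_       : Decidable _≈_
    _⁻¹       : Carrier → Carrier
    inverseʳ  : ∀ x → ¬ (x ≈ 0#) → (x * (x ⁻¹)) ≈ 1#
    1≉0       : ¬ (1# ≈ 0#)
    enum      : Fin q → Carrier
    enum-inj  : ∀ i j → enum i ≈ enum j → i ≡ j
    enum-surj : ∀ x → ∃ λ i → enum i ≈ x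

module _ {c ℓ : Level} {q : ℕ} (F : FiniteField c ℓ q) where
  open FiniteField F

  pow : Carrier → ℕ → Carrier
  pow x zero    = 1#
  pow x (suc n) = x * pow x n

  ι : ℕ → Carrier
  ι zero    = 0#
  ι (suc s) = 1# + ι s

  trace : (p m : ℕ) → Carrier → Carrier
  trace p zero    γ = 0#
  trace p (suc k) γ = trace p k γ + pow γ (p ^ k)

  T : (p m : ℕ) → ℕ → ℕ → ℕ
  T p m i j = length (filter P? (allFin q))
    where
    P? : (k : Fin q) → _
    P? k = ¬? (enum k ≟ 0#)
           ×-dec (trace p m (enum k) ≟ ι i)
           ×-dec (trace p m ((enum k) ⁻¹) ≟ ι j)

module Submission where

-- The map x ↦ x ^ p is additive
-- (binomial theorem) and fixes exactly the p elements ι 0, …, ι (p - 1) of the prime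
-- field (the roots of X ^ p - X); with x ^ q = x this makes tr an 𝔽ₚ-linear map into
-- 𝔽ₚ, and tr is not identically zero, being a polynomial of degree p ^ (m - 1) < q.
-- Translating by an element of trace s shows that every fibre {tr x = s} has q / p
-- elements. Summing T 1 s over s counts the fibre over 1, and summing T 0 s counts the
-- fibre over 0 without x = 0. For s ≠ 0, x ↦ (s x)⁻¹ maps {tr x = 0, tr x⁻¹ = s} onto
-- {tr y = 1, tr y⁻¹ = 0}, so T 0 s = T 1 0, and eliminating T 1 0 between the two row
-- sums gives the second identity.

open import Defs
open import Level using (Level; _⊔_)
open import Function using (_∘_)
open import Data.Empty using (⊥-elim)
open import Data.Product using (∃; _,_; proj₁; proj₂)
open import Data.Sum using (inj₁; inj₂)
open import Data.Nat as ℕ using (ℕ; zero; suc; nonTrivial⇒n>1; _<_; _≤_; _≥_; _∸_; z≤n; s≤s)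
import Data.Nat.Properties as ℕ
open import Data.Nat.Combinatorics using (_C_; nCk+nC[k+1]≡[n+1]C[k+1]; nC1≡n; nCn≡1)
open import Data.Nat.Divisibility using (_∣_; divides; ∣⇒≤)
open import Data.Nat.Primality using (Prime; euclidsLemma; prime⇒nonZero; prime⇒nonTrivial; ¬prime[0]; ¬prime[1])
open import Data.Nat.Tactic.RingSolver using (solve-∀)
open import Data.Nat.ListAction using (sum)
open import Data.Fin as Fin using (Fin; toℕ)
import Data.Fin.Properties as Fin
open import Data.List using (List; []; _∷_; length; filter; tabulate; applyUpTo; map; upTo)
open import Relation.Nullary using (¬_; Dec; yes; no; ¬?)
open import Relation.Nullary.Decidable using (_×-dec_)
open import Relation.Unary using (Pred)
import Relation.Unary as U
open import Relation.Binary.Definitions using (_Respects_; tri<; tri≈; tri>)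
open import Relation.Binary.PropositionalEquality as ≡ using (_≡_; _≢_)
import Algebra.Properties.CommutativeMonoid.Sum
open import Algebra.Properties.CommutativeMonoid.Sum ℕ.+-0-commutativeMonoid
  using (sum-syntax; sum-cong-≗; ∑-comm; ∑-distrib-+; sum-permute)

[k+1]*[n+1]C[k+1]≡[n+1]*nCk : ∀ n k → suc k ℕ.* (suc n C suc k) ≡ suc n ℕ.* (n C k)
[k+1]*[n+1]C[k+1]≡[n+1]*nCk zero zero = ≡.refl
[k+1]*[n+1]C[k+1]≡[n+1]*nCk zero (suc k) = ℕ.*-zeroʳ (2 ℕ.+ k)
[k+1]*[n+1]C[k+1]≡[n+1]*nCk (suc n) zero =
  ≡.trans (ℕ.*-identityˡ _) (≡.trans (nC1≡n (suc (suc n))) (≡.sym (ℕ.*-identityʳ _)))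
[k+1]*[n+1]C[k+1]≡[n+1]*nCk (suc n) (suc k) = begin
  (2 ℕ.+ k) ℕ.* ((2 ℕ.+ n) C (2 ℕ.+ k))
    ≡⟨ ≡.cong ((2 ℕ.+ k) ℕ.*_) (nCk+nC[k+1]≡[n+1]C[k+1] (suc n) (suc k)) ⟨
  (2 ℕ.+ k) ℕ.* (A ℕ.+ B)
    ≡⟨ split (1 ℕ.+ k) A B ⟩
  (1 ℕ.+ k) ℕ.* A ℕ.+ A ℕ.+ (2 ℕ.+ k) ℕ.* B
    ≡⟨ ≡.cong₂ (λ u v → u ℕ.+ A ℕ.+ v) ([k+1]*[n+1]C[k+1]≡[n+1]*nCk n k) ([k+1]*[n+1]C[k+1]≡[n+1]*nCk n (suc k)) ⟩
  (1 ℕ.+ n) ℕ.* (n C k) ℕ.+ A ℕ.+ (1 ℕ.+ n) ℕ.* (n C suc k)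
    ≡⟨ merge (1 ℕ.+ n) (n C k) (n C suc k) A ⟩
  (1 ℕ.+ n) ℕ.* (n C k ℕ.+ n C suc k) ℕ.+ A
    ≡⟨ ≡.cong (λ z → (1 ℕ.+ n) ℕ.* z ℕ.+ A) (nCk+nC[k+1]≡[n+1]C[k+1] n k) ⟩
  (1 ℕ.+ n) ℕ.* A ℕ.+ A
    ≡⟨ ℕ.+-comm ((1 ℕ.+ n) ℕ.* A) A ⟩
  (2 ℕ.+ n) ℕ.* A ∎
  where
  open ≡.≡-Reasoning
  A = suc n C suc k
  B = suc n C suc (suc k)
  split : ∀ a x y → suc a ℕ.* (x ℕ.+ y) ≡ a ℕ.* x ℕ.+ x ℕ.+ suc a ℕ.* y
  split = solve-∀
  merge : ∀ a x y z → a ℕ.* x ℕ.+ z ℕ.+ a ℕ.* y ≡ a ℕ.* (x ℕ.+ y) ℕ.+ z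
  merge = solve-∀

p∣pCk : ∀ {p k} → Prime p → 0 < k → k < p → p ∣ p C k
p∣pCk {suc p′} {suc k} p-prime _ k<p
  with euclidsLemma (suc k) (suc p′ C suc k) p-prime
         (divides (p′ C k) (≡.trans ([k+1]*[n+1]C[k+1]≡[n+1]*nCk p′ k) (ℕ.*-comm (suc p′) (p′ C k))))
... | inj₂ p∣C = p∣C
... | inj₁ p∣k+1 = ⊥-elim (ℕ.<⇒≱ k<p (∣⇒≤ p∣k+1))

private
  variable
    a b : Level
    A : Set a
    B : Set b

𝟙 : Dec A → ℕ
𝟙 (yes _) = 1
𝟙 (no _)  = 0

𝟙-yes : A → (d : Dec A) → 𝟙 d ≡ 1
𝟙-yes x (yes _) = ≡.refl
𝟙-yes x (no ¬x) = ⊥-elim (¬x x)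

𝟙-no : ¬ A → (d : Dec A) → 𝟙 d ≡ 0
𝟙-no ¬x (yes x) = ⊥-elim (¬x x)
𝟙-no ¬x (no _)  = ≡.refl

𝟙-cong : (A → B) → (B → A) → (d : Dec A) (e : Dec B) → 𝟙 d ≡ 𝟙 e
𝟙-cong f g (yes _) (yes _) = ≡.refl
𝟙-cong f g (yes x) (no ¬y) = ⊥-elim (¬y (f x))
𝟙-cong f g (no ¬x) (yes y) = ⊥-elim (¬x (g y))
𝟙-cong f g (no _)  (no _)  = ≡.refl

𝟙-¬×+𝟙 : (d : Dec A) (e : Dec B) → (A → B) → 𝟙 (¬? d ×-dec e) ℕ.+ 𝟙 d ≡ 𝟙 e
𝟙-¬×+𝟙 (yes x) e A⇒B =
  ≡.trans (≡.cong (ℕ._+ 1) (𝟙-no (λ (¬x , _) → ¬x x) (¬? (yes x) ×-dec e))) (≡.sym (𝟙-yes (A⇒B x) e))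
𝟙-¬×+𝟙 (no ¬x) e A⇒B = ≡.trans (ℕ.+-identityʳ _) (𝟙-cong proj₂ (¬x ,_) (¬? (no ¬x) ×-dec e) e)

𝟙-¬× : (d : Dec A) (e : Dec B) → (A → ¬ B) → 𝟙 (¬? d ×-dec e) ≡ 𝟙 e
𝟙-¬× d e A⇒¬B = 𝟙-cong proj₂ (λ y → (λ x → A⇒¬B x y) , y) (¬? d ×-dec e) e

𝟙-¬+𝟙 : (d : Dec A) → 𝟙 (¬? d) ℕ.+ 𝟙 d ≡ 1
𝟙-¬+𝟙 (yes _) = ≡.refl
𝟙-¬+𝟙 (no _)  = ≡.refl

∑-const : ∀ n k → ∑[ i < n ] k ≡ n ℕ.* k
∑-const zero    k = ≡.refl
∑-const (suc n) k = ≡.cong (k ℕ.+_) (∑-const n k)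

∑𝟙-none : ∀ {n r} {P : Pred (Fin n) r} (P? : U.Decidable P) →
          (∀ i → ¬ P i) → ∑[ i < n ] 𝟙 (P? i) ≡ 0
∑𝟙-none {zero}  P? ¬P = ≡.refl
∑𝟙-none {suc n} P? ¬P =
  ≡.cong₂ ℕ._+_ (𝟙-no (¬P Fin.zero) (P? Fin.zero)) (∑𝟙-none (P? ∘ Fin.suc) (¬P ∘ Fin.suc))

∑𝟙-unique : ∀ {n r} {P : Pred (Fin n) r} (P? : U.Decidable P) {j : Fin n} →
            P j → (∀ i → P i → i ≡ j) → ∑[ i < n ] 𝟙 (P? i) ≡ 1
∑𝟙-unique {suc n} P? {Fin.zero} Pj unique =
  ≡.cong₂ ℕ._+_ (𝟙-yes Pj (P? Fin.zero))
    (∑𝟙-none (P? ∘ Fin.suc) (λ i Pi → Fin.0≢1+n (≡.sym (unique (Fin.suc i) Pi))))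
∑𝟙-unique {suc n} P? {Fin.suc j} Pj unique =
  ≡.cong₂ ℕ._+_ (𝟙-no (λ P0 → Fin.0≢1+n (unique Fin.zero P0)) (P? Fin.zero))
    (∑𝟙-unique (P? ∘ Fin.suc) Pj (λ i Pi → Fin.suc-injective (unique (Fin.suc i) Pi)))

∑𝟙-¬+∑𝟙 : ∀ {n r} {P : Pred (Fin n) r} (P? : U.Decidable P) →
          ∑[ i < n ] 𝟙 (¬? (P? i)) ℕ.+ ∑[ i < n ] 𝟙 (P? i) ≡ n
∑𝟙-¬+∑𝟙 {n} P? = begin
  ∑[ i < n ] 𝟙 (¬? (P? i)) ℕ.+ ∑[ i < n ] 𝟙 (P? i)  ≡⟨ ∑-distrib-+ (λ i → 𝟙 (¬? (P? i))) (λ i → 𝟙 (P? i)) ⟨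
  ∑[ i < n ] (𝟙 (¬? (P? i)) ℕ.+ 𝟙 (P? i))           ≡⟨ sum-cong-≗ (λ i → 𝟙-¬+𝟙 (P? i)) ⟩
  ∑[ i < n ] 1                                     ≡⟨ ∑-const n 1 ⟩
  n ℕ.* 1                                          ≡⟨ ℕ.*-identityʳ n ⟩
  n                                                ∎
  where open ≡.≡-Reasoning

length-filter-tabulate : ∀ {r} {P : Pred A r} (P? : U.Decidable P) {n} (f : Fin n → A) →
                         length (filter P? (tabulate f)) ≡ ∑[ i < n ] 𝟙 (P? (f i))
length-filter-tabulate P? {zero}  f = ≡.refl
length-filter-tabulate P? {suc n} f with P? (f Fin.zero)
... | yes _ = ≡.cong suc (length-filter-tabulate P? (f ∘ Fin.suc))
... | no  _ = length-filter-tabulate P? (f ∘ Fin.suc)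

sum-applyUpTo : ∀ (f : ℕ → ℕ) n → sum (applyUpTo f n) ≡ ∑[ i < n ] f (toℕ i)
sum-applyUpTo f zero    = ≡.refl
sum-applyUpTo f (suc n) = ≡.cong (f 0 ℕ.+_) (sum-applyUpTo (f ∘ suc) n)

module FieldProperties {c ℓ q} (F : FiniteField c ℓ q) where

  open FiniteField F
  open import Algebra.Properties.Ring ring using (+-identityʳ-unique)
  open import Algebra.Properties.Semiring.Exp semiring public
    using (_^_; ^-congˡ; ^-congʳ; ^-homo-*; ^-assocʳ)
  open import Algebra.Properties.CommutativeSemiring.Exp commutativeSemiring public
    using (^-distrib-*)
  open import Algebra.Properties.Semiring.Mult semiring public
    using (_×_; ×-congʳ; ×-homo-+; ×1-homo-*; ×-assoc-*)
  open import Algebra.Properties.CommutativeSemiring.Binomial commutativeSemiring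
    using (theorem; binomialTerm)
  open import Data.Fin.Permutation using (Permutation′; permutation; _⟨$⟩ʳ_)
  module ∑ = Algebra.Properties.CommutativeMonoid.Sum +-commutativeMonoid
  module ∏ = Algebra.Properties.CommutativeMonoid.Sum *-commutativeMonoid
  open import Relation.Binary.Reasoning.Setoid setoid

  inverseˡ : ∀ {x} → x ≉ 0# → x ⁻¹ * x ≈ 1#
  inverseˡ {x} x≉0 = trans (*-comm (x ⁻¹) x) (inverseʳ x x≉0)

  *-cancelˡ : ∀ {x} y z → x ≉ 0# → x * y ≈ x * z → y ≈ z
  *-cancelˡ {x} y z x≉0 xy≈xz = begin
    y                ≈⟨ *-identityˡ y ⟨
    1# * y           ≈⟨ *-congʳ (inverseˡ x≉0) ⟨
    (x ⁻¹ * x) * y   ≈⟨ *-assoc (x ⁻¹) x y ⟩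
    x ⁻¹ * (x * y)   ≈⟨ *-congˡ xy≈xz ⟩
    x ⁻¹ * (x * z)   ≈⟨ *-assoc (x ⁻¹) x z ⟨
    (x ⁻¹ * x) * z   ≈⟨ *-congʳ (inverseˡ x≉0) ⟩
    1# * z           ≈⟨ *-identityˡ z ⟩
    z                ∎

  x*y≈0⇒y≈0 : ∀ {x y} → x ≉ 0# → x * y ≈ 0# → y ≈ 0#
  x*y≈0⇒y≈0 {x} {y} x≉0 xy≈0 = *-cancelˡ y 0# x≉0 (trans xy≈0 (sym (zeroʳ x)))

  *-nonzero : ∀ {x y} → x ≉ 0# → y ≉ 0# → x * y ≉ 0#
  *-nonzero x≉0 y≉0 xy≈0 = y≉0 (x*y≈0⇒y≈0 x≉0 xy≈0)

  ^-nonzero : ∀ {x} n → x ≉ 0# → x ^ n ≉ 0#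
  ^-nonzero zero    x≉0 = 1≉0
  ^-nonzero (suc n) x≉0 = *-nonzero x≉0 (^-nonzero n x≉0)

  ^≈0⇒≈0 : ∀ {x} n → x ^ n ≈ 0# → x ≈ 0#
  ^≈0⇒≈0 {x} n xⁿ≈0 with x ≟ 0#
  ... | yes x≈0 = x≈0
  ... | no  x≉0 = ⊥-elim (^-nonzero n x≉0 xⁿ≈0)

  ⁻¹-unique : ∀ {x y} → x ≉ 0# → x * y ≈ 1# → y ≈ x ⁻¹
  ⁻¹-unique {x} {y} x≉0 xy≈1 = *-cancelˡ y (x ⁻¹) x≉0 (trans xy≈1 (sym (inverseʳ x x≉0)))

  ⁻¹-nonzero : ∀ {x} → x ≉ 0# → x ⁻¹ ≉ 0#
  ⁻¹-nonzero {x} x≉0 x⁻¹≈0 = 1≉0 (trans (sym (inverseʳ x x≉0)) (trans (*-congˡ x⁻¹≈0) (zeroʳ x)))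

  ⁻¹-cong : ∀ {x y} → x ≉ 0# → x ≈ y → x ⁻¹ ≈ y ⁻¹
  ⁻¹-cong {x} {y} x≉0 x≈y =
    ⁻¹-unique (x≉0 ∘ trans x≈y) (trans (*-congʳ (sym x≈y)) (inverseʳ x x≉0))

  ⁻¹-involutive : ∀ {x} → x ≉ 0# → x ⁻¹ ⁻¹ ≈ x
  ⁻¹-involutive x≉0 = sym (⁻¹-unique (⁻¹-nonzero x≉0) (inverseˡ x≉0))

  ⁻¹-distrib-* : ∀ {x y} → x ≉ 0# → y ≉ 0# → (x * y) ⁻¹ ≈ x ⁻¹ * y ⁻¹
  ⁻¹-distrib-* {x} {y} x≉0 y≉0 = sym (⁻¹-unique (*-nonzero x≉0 y≉0) (begin
    (x * y) * (x ⁻¹ * y ⁻¹)      ≈⟨ *-assoc x y _ ⟩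
    x * (y * (x ⁻¹ * y ⁻¹))      ≈⟨ *-congˡ (x∙yz≈y∙xz y (x ⁻¹) (y ⁻¹)) ⟩
    x * (x ⁻¹ * (y * y ⁻¹))      ≈⟨ *-assoc x (x ⁻¹) _ ⟨
    (x * x ⁻¹) * (y * y ⁻¹)      ≈⟨ *-cong (inverseʳ x x≉0) (inverseʳ y y≉0) ⟩
    1# * 1#                      ≈⟨ *-identityˡ 1# ⟩
    1#                           ∎))
    where open import Algebra.Properties.CommutativeSemigroup *-commutativeSemigroup using (x∙yz≈y∙xz)

  pow≈^ : ∀ x n → pow F x n ≈ x ^ n
  pow≈^ x zero    = refl
  pow≈^ x (suc n) = *-congˡ (pow≈^ x n)

  ι≈×1 : ∀ n → ι F n ≈ n × 1#
  ι≈×1 zero    = refl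
  ι≈×1 (suc n) = +-congˡ (ι≈×1 n)

  ι-+ : ∀ m n → ι F (m ℕ.+ n) ≈ ι F m + ι F n
  ι-+ m n = begin
    ι F (m ℕ.+ n)          ≈⟨ ι≈×1 (m ℕ.+ n) ⟩
    (m ℕ.+ n) × 1#         ≈⟨ ×-homo-+ 1# m n ⟩
    m × 1# + n × 1#        ≈⟨ +-cong (ι≈×1 m) (ι≈×1 n) ⟨
    ι F m + ι F n          ∎

  ι-* : ∀ m n → ι F (m ℕ.* n) ≈ ι F m * ι F n
  ι-* m n = begin
    ι F (m ℕ.* n)          ≈⟨ ι≈×1 (m ℕ.* n) ⟩
    (m ℕ.* n) × 1#         ≈⟨ ×1-homo-* m n ⟩
    m × 1# * n × 1#        ≈⟨ *-cong (ι≈×1 m) (ι≈×1 n) ⟨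
    ι F m * ι F n          ∎

  ι-^ : ∀ m n → ι F (m ℕ.^ n) ≈ ι F m ^ n
  ι-^ m zero    = +-identityʳ 1#
  ι-^ m (suc n) = trans (ι-* m (m ℕ.^ n)) (*-congˡ (ι-^ m n))

  ×≈ι* : ∀ n x → n × x ≈ ι F n * x
  ×≈ι* n x = begin
    n × x                  ≈⟨ ×-congʳ n (*-identityˡ x) ⟨
    n × (1# * x)           ≈⟨ ×-assoc-* n 1# x ⟨
    n × 1# * x             ≈⟨ *-congʳ (ι≈×1 n) ⟨
    ι F n * x              ∎

  index : Carrier → Fin q
  index x = proj₁ (enum-surj x)

  enum-index : ∀ x → enum (index x) ≈ x
  enum-index x = proj₂ (enum-surj x)

  count : ∀ {r} {P : Pred Carrier r} → U.Decidable P → ℕ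
  count P? = ∑[ i < q ] 𝟙 (P? (enum i))

  count-≈ : ∀ x → count (_≟ x) ≡ 1
  count-≈ x = ∑𝟙-unique (λ i → enum i ≟ x) (enum-index x)
    (λ i eᵢ≈x → enum-inj i (index x) (trans eᵢ≈x (sym (enum-index x))))

  count-¬+count : ∀ {r} {P : Pred Carrier r} (P? : U.Decidable P) → count (¬? ∘ P?) ℕ.+ count P? ≡ q
  count-¬+count P? = ∑𝟙-¬+∑𝟙 (P? ∘ enum)

  record Permutation : Set (c ⊔ ℓ) where
    field
      to from   : Carrier → Carrier
      to-cong   : ∀ {x y} → x ≈ y → to x ≈ to y
      from-cong : ∀ {x y} → x ≈ y → from x ≈ from y
      to-from   : ∀ x → to (from x) ≈ x
      from-to   : ∀ x → from (to x) ≈ x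

  open Permutation public using (to)

  reindex : Permutation → Permutation′ q
  reindex π = permutation (index ∘ to π ∘ enum) (index ∘ from ∘ enum)
    (λ i → enum-inj _ _ (trans (enum-index _) (trans (to-cong (enum-index _)) (to-from (enum i)))))
    (λ i → enum-inj _ _ (trans (enum-index _) (trans (from-cong (enum-index _)) (from-to (enum i)))))
    where open Permutation π using (from; to-cong; from-cong; to-from; from-to)

  enum-reindex : ∀ π i → enum (reindex π ⟨$⟩ʳ i) ≈ to π (enum i)
  enum-reindex π i = enum-index (to π (enum i))

  count-permute : ∀ {r s} {P : Pred Carrier r} {Q : Pred Carrier s}
                  (P? : U.Decidable P) (Q? : U.Decidable Q) (π : Permutation) → P Respects _≈_ →
                  (∀ x → P (to π x) → Q x) → (∀ x → Q x → P (to π x)) → count P? ≡ count Q?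
  count-permute P? Q? π P-resp P∘π⇒Q Q⇒P∘π =
    ≡.trans (sum-permute (λ i → 𝟙 (P? (enum i))) (reindex π))
      (sum-cong-≗ λ i → 𝟙-cong
        (λ P[eπi] → P∘π⇒Q (enum i) (P-resp (enum-reindex π i) P[eπi]))
        (λ Q[ei] → P-resp (sym (enum-reindex π i)) (Q⇒P∘π (enum i) Q[ei]))
        (P? (enum (reindex π ⟨$⟩ʳ i))) (Q? (enum i)))

  translation : Carrier → Permutation
  translation z = record
    { to        = _+ z
    ; from      = _- z
    ; to-cong   = +-congʳ
    ; from-cong = +-congʳ
    ; to-from   = λ x → trans (+-assoc x (- z) z) (trans (+-congˡ (-‿inverseˡ z)) (+-identityʳ x))
    ; from-to   = λ x → trans (+-assoc x z (- z)) (trans (+-congˡ (-‿inverseʳ z)) (+-identityʳ x))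
    }

  scaling : ∀ {a} → a ≉ 0# → Permutation
  scaling {a} a≉0 = record
    { to        = a *_
    ; from      = a ⁻¹ *_
    ; to-cong   = *-congˡ
    ; from-cong = *-congˡ
    ; to-from   = λ x → trans (sym (*-assoc a (a ⁻¹) x)) (trans (*-congʳ (inverseʳ a a≉0)) (*-identityˡ x))
    ; from-to   = λ x → trans (sym (*-assoc (a ⁻¹) a x)) (trans (*-congʳ (inverseˡ a≉0)) (*-identityˡ x))
    }

  _∘ₚ_ : Permutation → Permutation → Permutation
  π ∘ₚ σ = record
    { to        = to π ∘ to σ
    ; from      = from σ ∘ from π
    ; to-cong   = to-cong π ∘ to-cong σ
    ; from-cong = from-cong σ ∘ from-cong π
    ; to-from   = λ x → trans (to-cong π (to-from σ (from π x))) (to-from π x)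
    ; from-to   = λ x → trans (from-cong σ (from-to π (to σ x))) (from-to σ x)
    }
    where open Permutation

  -- x ⁻¹ is unconstrained at 0; sending 0 to 0 makes inversion a bijection.
  inv₀ : Carrier → Carrier
  inv₀ x with x ≟ 0#
  ... | yes _ = 0#
  ... | no  _ = x ⁻¹

  inv₀-zero : ∀ {x} → x ≈ 0# → inv₀ x ≈ 0#
  inv₀-zero {x} x≈0 with x ≟ 0#
  ... | yes _   = refl
  ... | no  x≉0 = ⊥-elim (x≉0 x≈0)

  inv₀-nonzero : ∀ {x} → x ≉ 0# → inv₀ x ≈ x ⁻¹
  inv₀-nonzero {x} x≉0 with x ≟ 0#
  ... | yes x≈0 = ⊥-elim (x≉0 x≈0)
  ... | no  _   = refl

  inv₀-cong : ∀ {x y} → x ≈ y → inv₀ x ≈ inv₀ y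
  inv₀-cong {x} {y} x≈y with x ≟ 0#
  ... | yes x≈0 = sym (inv₀-zero (trans (sym x≈y) x≈0))
  ... | no  x≉0 = trans (⁻¹-cong x≉0 x≈y) (sym (inv₀-nonzero (x≉0 ∘ trans x≈y)))

  inv₀-involutive : ∀ x → inv₀ (inv₀ x) ≈ x
  inv₀-involutive x with x ≟ 0#
  ... | yes x≈0 = trans (inv₀-zero refl) (sym x≈0)
  ... | no  x≉0 = trans (inv₀-nonzero (⁻¹-nonzero x≉0)) (⁻¹-involutive x≉0)

  inversion : Permutation
  inversion = record
    { to        = inv₀
    ; from      = inv₀
    ; to-cong   = inv₀-cong
    ; from-cong = inv₀-cong
    ; to-from   = inv₀-involutive
    ; from-to   = inv₀-involutive
    }

  ι-q≈0 : ι F q ≈ 0#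
  ι-q≈0 = trans (ι≈×1 q) (+-identityʳ-unique (∑.sum enum) (q × 1#) (sym (begin
    ∑.sum enum                                   ≈⟨ ∑.sum-permute enum (reindex (translation 1#)) ⟩
    ∑.sum (enum ∘ (reindex (translation 1#) ⟨$⟩ʳ_))  ≈⟨ ∑.sum-cong-≋ (enum-reindex (translation 1#)) ⟩
    ∑.sum (λ i → enum i + 1#)                     ≈⟨ ∑.∑-distrib-+ enum (λ _ → 1#) ⟩
    ∑.sum enum + ∑.sum {q} (λ _ → 1#)             ≈⟨ +-congˡ (∑.sum-replicate q) ⟩
    ∑.sum enum + q × 1#                          ∎)))

  -- Replacing 0 by 1 makes the product over all elements the product of the units.
  unitPart : Carrier → Carrier
  unitPart x with x ≟ 0#
  ... | yes _ = 1#
  ... | no  _ = x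

  unitPart-cong : ∀ {x y} → x ≈ y → unitPart x ≈ unitPart y
  unitPart-cong {x} {y} x≈y with x ≟ 0# | y ≟ 0#
  ... | yes _   | yes _   = refl
  ... | yes x≈0 | no  y≉0 = ⊥-elim (y≉0 (trans (sym x≈y) x≈0))
  ... | no  x≉0 | yes y≈0 = ⊥-elim (x≉0 (trans x≈y y≈0))
  ... | no  _   | no  _   = x≈y

  unitPart-nonzero : ∀ x → unitPart x ≉ 0#
  unitPart-nonzero x with x ≟ 0#
  ... | yes _   = 1≉0
  ... | no  x≉0 = x≉0

  unitPart-* : ∀ {a} → a ≉ 0# → ∀ x → unitPart (a * x) ≈ a ^ 𝟙 (¬? (x ≟ 0#)) * unitPart x
  unitPart-* {a} a≉0 x with x ≟ 0# | (a * x) ≟ 0#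
  ... | yes _   | yes _    = sym (*-identityˡ 1#)
  ... | yes x≈0 | no  ax≉0 = ⊥-elim (ax≉0 (trans (*-congˡ x≈0) (zeroʳ a)))
  ... | no  x≉0 | yes ax≈0 = ⊥-elim (x≉0 (x*y≈0⇒y≈0 a≉0 ax≈0))
  ... | no  _   | no  _    = *-congʳ (sym (*-identityʳ a))

  ∏-nonzero : ∀ {n} (f : Fin n → Carrier) → (∀ i → f i ≉ 0#) → ∏.sum f ≉ 0#
  ∏-nonzero {zero}  f f≉0 = 1≉0
  ∏-nonzero {suc n} f f≉0 = *-nonzero (f≉0 Fin.zero) (∏-nonzero (f ∘ Fin.suc) (f≉0 ∘ Fin.suc))

  ∏-^ : ∀ {n} a (e : Fin n → ℕ) → ∏.sum (λ i → a ^ e i) ≈ a ^ ∑[ i < n ] e i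
  ∏-^ {zero}  a e = refl
  ∏-^ {suc n} a e = trans (*-congˡ (∏-^ a (e ∘ Fin.suc))) (sym (^-homo-* a (e Fin.zero) _))

  ^-#nonzero≈1 : ∀ {a} → a ≉ 0# → a ^ count (¬? ∘ (_≟ 0#)) ≈ 1#
  ^-#nonzero≈1 {a} a≉0 = *-cancelˡ _ 1# (∏-nonzero u (unitPart-nonzero ∘ enum)) (begin
    ∏u * a ^ N                                   ≈⟨ *-comm ∏u _ ⟩
    a ^ N * ∏u                                   ≈⟨ *-congʳ (∏-^ a e) ⟨
    ∏.sum (λ i → a ^ e i) * ∏u                    ≈⟨ ∏.∑-distrib-+ (λ i → a ^ e i) u ⟨
    ∏.sum (λ i → a ^ e i * u i)                   ≈⟨ ∏.sum-cong-≋ (λ i → unitPart-* a≉0 (enum i)) ⟨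
    ∏.sum (λ i → unitPart (a * enum i))           ≈⟨ ∏.sum-cong-≋ (λ i → unitPart-cong (enum-reindex π i)) ⟨
    ∏.sum (u ∘ (reindex π ⟨$⟩ʳ_))                 ≈⟨ ∏.sum-permute u (reindex π) ⟨
    ∏u                                           ≈⟨ *-identityʳ ∏u ⟨
    ∏u * 1#                                      ∎)
    where
    π = scaling a≉0
    u = unitPart ∘ enum
    ∏u = ∏.sum u
    e = λ i → 𝟙 (¬? (enum i ≟ 0#))
    N = count (¬? ∘ (_≟ 0#))

  ^q≈id : ∀ x → x ^ q ≈ x
  ^q≈id x = begin
    x ^ q                   ≡⟨ ≡.cong (x ^_) q≡N+1 ⟩
    x ^ (N ℕ.+ 1)           ≈⟨ ^-homo-* x N 1 ⟩
    x ^ N * (x * 1#)        ≈⟨ *-congˡ (*-identityʳ x) ⟩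
    x ^ N * x               ≈⟨ xᴺ*x≈x (x ≟ 0#) ⟩
    x                       ∎
    where
    N = count (¬? ∘ (_≟ 0#))
    q≡N+1 : q ≡ N ℕ.+ 1
    q≡N+1 = ≡.trans (≡.sym (count-¬+count (_≟ 0#))) (≡.cong (N ℕ.+_) (count-≈ 0#))
    xᴺ*x≈x : Dec (x ≈ 0#) → x ^ N * x ≈ x
    xᴺ*x≈x (yes x≈0) = trans (*-congˡ x≈0) (trans (zeroʳ _) (sym x≈0))
    xᴺ*x≈x (no x≉0)  = trans (*-congʳ (^-#nonzero≈1 x≉0)) (*-identityˡ x)

  1^n≈1 : ∀ n → 1# ^ n ≈ 1#
  1^n≈1 zero    = refl
  1^n≈1 (suc n) = trans (*-identityˡ _) (1^n≈1 n)

  ⁻¹-^ : ∀ {x} n → x ≉ 0# → (x ⁻¹) ^ n ≈ (x ^ n) ⁻¹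
  ⁻¹-^ {x} n x≉0 = ⁻¹-unique (^-nonzero n x≉0) (begin
    x ^ n * (x ⁻¹) ^ n     ≈⟨ ^-distrib-* x (x ⁻¹) n ⟨
    (x * x ⁻¹) ^ n         ≈⟨ ^-congˡ n (inverseʳ x x≉0) ⟩
    1# ^ n                 ≈⟨ 1^n≈1 n ⟩
    1#                     ∎)

  ι-multiple≈0 : ∀ {p n} → ι F p ≈ 0# → p ∣ n → ι F n ≈ 0#
  ι-multiple≈0 {p} ι-p≈0 (divides t ≡.refl) = trans (ι-* t p) (trans (*-congˡ ι-p≈0) (zeroʳ _))

  frobenius-+ : ∀ {p} → Prime p → ι F p ≈ 0# → ∀ x y → (x + y) ^ p ≈ x ^ p + y ^ p
  frobenius-+ {zero}   p-prime _     _ _ = ⊥-elim (¬prime[0] p-prime)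
  frobenius-+ {suc p′} p-prime ι-p≈0 x y = begin
    (x + y) ^ p                                      ≈⟨ theorem p x y ⟩
    ∑.sum t                                          ≈⟨ +-congˡ (∑.sum-init-last (t ∘ Fin.suc)) ⟩
    t Fin.zero + (∑.sum (t ∘ Fin.suc ∘ Fin.inject₁) + t (Fin.suc (Fin.fromℕ p′)))
                                                     ≈⟨ +-cong first (+-cong middle last) ⟩
    y ^ p + (0# + x ^ p)                             ≈⟨ +-congˡ (+-identityˡ _) ⟩
    y ^ p + x ^ p                                    ≈⟨ +-comm _ _ ⟩
    x ^ p + y ^ p                                    ∎
    where
    p = suc p′
    t = binomialTerm x y p
    first : t Fin.zero ≈ y ^ p
    first = trans (+-identityʳ _) (*-identityˡ _)
    middle : ∑.sum (t ∘ Fin.suc ∘ Fin.inject₁) ≈ 0#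
    middle = trans (∑.sum-cong-≋ t[1+j]≈0) (∑.sum-replicate-zero p′)
      where
      t[1+j]≈0 : ∀ j → t (Fin.suc (Fin.inject₁ j)) ≈ 0#
      t[1+j]≈0 j = trans (×≈ι* (p C k) _) (trans (*-congʳ (ι-multiple≈0 ι-p≈0
                     (p∣pCk p-prime (s≤s z≤n) (s≤s (Fin.inject₁ℕ< j))))) (zeroˡ _))
        where k = suc (toℕ (Fin.inject₁ j))
    last : t (Fin.suc (Fin.fromℕ p′)) ≈ x ^ p
    last = begin
      t (Fin.suc (Fin.fromℕ p′))           ≡⟨ ≡.cong (λ k → (p C k) × (x ^ k * y ^ (p ∸ k))) (≡.cong suc (Fin.toℕ-fromℕ p′)) ⟩
      (p C p) × (x ^ p * y ^ (p ∸ p))      ≡⟨ ≡.cong₂ (λ a b → a × (x ^ p * y ^ b)) (nCn≡1 p) (ℕ.n∸n≡0 p) ⟩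
      1 × (x ^ p * 1#)                     ≈⟨ trans (+-identityʳ _) (*-identityʳ _) ⟩
      x ^ p                                ∎

  module Characteristic {p} (p-prime : Prime p) (ι-p≈0 : ι F p ≈ 0#) where

    open import Data.Nat.GCD using (module Bézout)
    open import Data.Nat.Coprimality using (coprime-Bézout; prime⇒coprime)

    1+u*a≢v*b : ∀ {a b} u v → ι F a ≈ 0# → ι F b ≈ 0# → 1 ℕ.+ u ℕ.* a ≢ v ℕ.* b
    1+u*a≢v*b {a} {b} u v ι-a≈0 ι-b≈0 eq = 1≉0 (begin
      1#                       ≈⟨ +-identityʳ 1# ⟨
      1# + 0#                  ≈⟨ +-congˡ (trans (ι-* u a) (trans (*-congˡ ι-a≈0) (zeroʳ _))) ⟨
      ι F (1 ℕ.+ u ℕ.* a)      ≡⟨ ≡.cong (ι F) eq ⟩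
      ι F (v ℕ.* b)            ≈⟨ ι-* v b ⟩
      ι F v * ι F b            ≈⟨ trans (*-congˡ ι-b≈0) (zeroʳ _) ⟩
      0#                       ∎)

    ι-nonzero : ∀ {d} → 0 < d → d < p → ι F d ≉ 0#
    ι-nonzero {suc d} _ d<p ι-d≈0 with coprime-Bézout (prime⇒coprime p-prime d<p)
    ... | Bézout.+- x y 1+y*d≡x*p = 1+u*a≢v*b y x ι-d≈0 ι-p≈0 1+y*d≡x*p
    ... | Bézout.-+ x y 1+x*p≡y*d = 1+u*a≢v*b x y ι-p≈0 ι-d≈0 1+x*p≡y*d

    ι-≉-< : ∀ {m n} → m < n → n < p → ι F m ≉ ι F n
    ι-≉-< {m} m<n n<p ιm≈ιn with ℕ.m≤n⇒∃[o]m+o≡n (ℕ.<⇒≤ m<n)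
    ... | zero  , ≡.refl = ℕ.<-irrefl (≡.sym (ℕ.+-identityʳ m)) m<n
    ... | suc d , ≡.refl = ι-nonzero (s≤s z≤n) (ℕ.≤-<-trans (ℕ.m≤n+m (suc d) m) n<p)
                             (+-identityʳ-unique (ι F m) _ (trans (sym (ι-+ m (suc d))) (sym ιm≈ιn)))

    ι-injective : ∀ (i j : Fin p) → ι F (toℕ i) ≈ ι F (toℕ j) → i ≡ j
    ι-injective i j ιi≈ιj with ℕ.<-cmp (toℕ i) (toℕ j)
    ... | tri< i<j _ _ = ⊥-elim (ι-≉-< i<j (Fin.toℕ<n j) ιi≈ιj)
    ... | tri≈ _ i≡j _ = Fin.toℕ-injective i≡j
    ... | tri> _ _ j<i = ⊥-elim (ι-≉-< j<i (Fin.toℕ<n i) (sym ιi≈ιj))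

    1<p : 1 < p
    1<p = nonTrivial⇒n>1 p {{prime⇒nonTrivial p-prime}}

    0^p≈0 : 0# ^ p ≈ 0#
    0^p≈0 = +-identityʳ-unique (0# ^ p) (0# ^ p)
      (trans (sym (frobenius-+ p-prime ι-p≈0 0# 0#)) (^-congˡ p (+-identityʳ 0#)))

    ι^p≈ι : ∀ s → ι F s ^ p ≈ ι F s
    ι^p≈ι zero    = 0^p≈0
    ι^p≈ι (suc s) = trans (frobenius-+ p-prime ι-p≈0 1# (ι F s)) (+-cong (1^n≈1 p) (ι^p≈ι s))

    frobenius-+ⁿ : ∀ k x y → (x + y) ^ (p ℕ.^ k) ≈ x ^ (p ℕ.^ k) + y ^ (p ℕ.^ k)
    frobenius-+ⁿ zero    x y = trans (*-identityʳ _) (sym (+-cong (*-identityʳ x) (*-identityʳ y)))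
    frobenius-+ⁿ (suc k) x y = begin
      (x + y) ^ (p ℕ.* p ℕ.^ k)                      ≈⟨ ^-assocʳ (x + y) p (p ℕ.^ k) ⟨
      ((x + y) ^ p) ^ (p ℕ.^ k)                      ≈⟨ ^-congˡ (p ℕ.^ k) (frobenius-+ p-prime ι-p≈0 x y) ⟩
      (x ^ p + y ^ p) ^ (p ℕ.^ k)                    ≈⟨ frobenius-+ⁿ k (x ^ p) (y ^ p) ⟩
      (x ^ p) ^ (p ℕ.^ k) + (y ^ p) ^ (p ℕ.^ k)      ≈⟨ +-cong (^-assocʳ x p (p ℕ.^ k)) (^-assocʳ y p (p ℕ.^ k)) ⟩
      x ^ (p ℕ.* p ℕ.^ k) + y ^ (p ℕ.* p ℕ.^ k)      ∎

    ^p≈id⇒^pⁿ≈id : ∀ {a} → a ^ p ≈ a → ∀ k → a ^ (p ℕ.^ k) ≈ a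
    ^p≈id⇒^pⁿ≈id {a} aᵖ≈a zero    = *-identityʳ a
    ^p≈id⇒^pⁿ≈id {a} aᵖ≈a (suc k) =
      trans (sym (^-assocʳ a p (p ℕ.^ k))) (trans (^-congˡ (p ℕ.^ k) aᵖ≈a) (^p≈id⇒^pⁿ≈id aᵖ≈a k))

module Polynomial {c ℓ q} (F : FiniteField c ℓ q) where

  open FiniteField F
  open FieldProperties F using (_^_; x*y≈0⇒y≈0)
  open import Algebra.Properties.Ring ring using (x∙y⁻¹≈ε⇒x≈y)
  open import Algebra.Properties.CommutativeSemigroup +-commutativeSemigroup
    using (interchange; x∙yz≈y∙xz)
  open import Data.List.Relation.Unary.All using (All; []; _∷_)
  open import Data.List.Relation.Unary.AllPairs using (AllPairs; []; _∷_)
  open import Relation.Binary.Reasoning.Setoid setoid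

  Poly : Set c
  Poly = List Carrier

  eval : Poly → Carrier → Carrier
  eval []      x = 0#
  eval (a ∷ f) x = a + x * eval f x

  infixl 6 _+ₚ_
  _+ₚ_ : Poly → Poly → Poly
  []      +ₚ g       = g
  (a ∷ f) +ₚ []      = a ∷ f
  (a ∷ f) +ₚ (b ∷ g) = (a + b) ∷ (f +ₚ g)

  eval-+ₚ : ∀ f g x → eval (f +ₚ g) x ≈ eval f x + eval g x
  eval-+ₚ []      g       x = sym (+-identityˡ _)
  eval-+ₚ (a ∷ f) []      x = sym (+-identityʳ _)
  eval-+ₚ (a ∷ f) (b ∷ g) x = begin
    (a + b) + x * eval (f +ₚ g) x              ≈⟨ +-congˡ (*-congˡ (eval-+ₚ f g x)) ⟩
    (a + b) + x * (eval f x + eval g x)        ≈⟨ +-congˡ (distribˡ x _ _) ⟩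
    (a + b) + (x * eval f x + x * eval g x)    ≈⟨ interchange a b _ _ ⟩
    (a + x * eval f x) + (b + x * eval g x)    ∎

  X^ : ℕ → Poly
  X^ zero    = 1# ∷ []
  X^ (suc n) = 0# ∷ X^ n

  eval-X^ : ∀ n x → eval (X^ n) x ≈ x ^ n
  eval-X^ zero    x = trans (+-congˡ (zeroʳ x)) (+-identityʳ 1#)
  eval-X^ (suc n) x = trans (+-identityˡ _) (*-congˡ (eval-X^ n x))

  length-+ₚX^ : ∀ f n → length f ≤ n → length (f +ₚ X^ n) ≡ suc n
  length-+ₚX^ []      zero    _         = ≡.refl
  length-+ₚX^ []      (suc n) _         = ≡.cong suc (length-+ₚX^ [] n z≤n)
  length-+ₚX^ (a ∷ f) (suc n) (s≤s f≤n) = ≡.cong suc (length-+ₚX^ f n f≤n)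

  IsZero : Poly → Set (c ⊔ ℓ)
  IsZero = All (_≈ 0#)

  +ₚX^-nonzero : ∀ f n → length f ≤ n → ¬ IsZero (f +ₚ X^ n)
  +ₚX^-nonzero []      zero    _         (1≈0 ∷ _) = 1≉0 1≈0
  +ₚX^-nonzero []      (suc n) _         (_ ∷ z)   = +ₚX^-nonzero [] n z≤n z
  +ₚX^-nonzero (a ∷ f) (suc n) (s≤s f≤n) (_ ∷ z)   = +ₚX^-nonzero f n f≤n z

  quotient : Carrier → Poly → Poly
  remainder : Carrier → Poly → Carrier
  quotient r []           = []
  quotient r (a ∷ [])     = []
  quotient r (a ∷ b ∷ f)  = remainder r (b ∷ f) ∷ quotient r (b ∷ f)
  remainder r []          = 0#
  remainder r (a ∷ [])    = a
  remainder r (a ∷ b ∷ f) = a + r * remainder r (b ∷ f)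

  eval-quotient : ∀ r f x → eval f x ≈ (x - r) * eval (quotient r f) x + remainder r f
  eval-quotient r []          x = sym (trans (+-identityʳ _) (zeroʳ _))
  eval-quotient r (a ∷ [])    x =
    trans (+-congˡ (zeroʳ x)) (trans (+-identityʳ a) (sym (trans (+-congʳ (zeroʳ _)) (+-identityˡ a))))
  eval-quotient r (a ∷ b ∷ f) x = begin
    a + x * eval (b ∷ f) x                      ≈⟨ +-congˡ (*-congˡ (eval-quotient r (b ∷ f) x)) ⟩
    a + x * ((x - r) * Q + ρ)                   ≈⟨ +-congˡ (distribˡ x _ ρ) ⟩
    a + (x * ((x - r) * Q) + x * ρ)             ≈⟨ +-congˡ (+-cong (x∙yz≈y∙xz′ x (x - r) Q) x*ρ) ⟩
    a + ((x - r) * (x * Q) + ((x - r) * ρ + r * ρ))  ≈⟨ +-congˡ (+-assoc _ _ (r * ρ)) ⟨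
    a + (((x - r) * (x * Q) + (x - r) * ρ) + r * ρ)  ≈⟨ +-congˡ (+-congʳ (distribˡ (x - r) (x * Q) ρ)) ⟨
    a + ((x - r) * (x * Q + ρ) + r * ρ)         ≈⟨ x∙yz≈y∙xz a _ (r * ρ) ⟩
    (x - r) * (x * Q + ρ) + (a + r * ρ)         ≈⟨ +-congʳ (*-congˡ (+-comm (x * Q) ρ)) ⟩
    (x - r) * (ρ + x * Q) + (a + r * ρ)         ∎
    where
    Q = eval (quotient r (b ∷ f)) x
    ρ = remainder r (b ∷ f)
    open import Algebra.Properties.CommutativeSemigroup *-commutativeSemigroup
      using () renaming (x∙yz≈y∙xz to x∙yz≈y∙xz′)
    x*ρ : x * ρ ≈ (x - r) * ρ + r * ρ
    x*ρ = begin
      x * ρ                  ≈⟨ *-congʳ (trans (+-assoc x (- r) r) (trans (+-congˡ (-‿inverseˡ r)) (+-identityʳ x))) ⟨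
      ((x - r) + r) * ρ      ≈⟨ distribʳ ρ (x - r) r ⟩
      (x - r) * ρ + r * ρ    ∎

  remainder≈eval : ∀ r f → remainder r f ≈ eval f r
  remainder≈eval r f = sym (begin
    eval f r                                         ≈⟨ eval-quotient r f r ⟩
    (r - r) * eval (quotient r f) r + remainder r f  ≈⟨ +-congʳ (trans (*-congʳ (-‿inverseʳ r)) (zeroˡ _)) ⟩
    0# + remainder r f                               ≈⟨ +-identityˡ _ ⟩
    remainder r f                                    ∎)

  length-quotient : ∀ r a f → length (quotient r (a ∷ f)) ≡ length f
  length-quotient r a []      = ≡.refl
  length-quotient r a (b ∷ f) = ≡.cong suc (length-quotient r b f)

  IsZero-quotient⇒IsZero : ∀ r f → IsZero (quotient r f) → remainder r f ≈ 0# → IsZero f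
  IsZero-quotient⇒IsZero r []          _         _   = []
  IsZero-quotient⇒IsZero r (a ∷ [])    _         a≈0 = a≈0 ∷ []
  IsZero-quotient⇒IsZero r (a ∷ b ∷ f) (ρ≈0 ∷ z) ρ′≈0 =
    a≈0 ∷ IsZero-quotient⇒IsZero r (b ∷ f) z ρ≈0
    where
    a≈0 : a ≈ 0#
    a≈0 = begin
      a                                    ≈⟨ +-identityʳ a ⟨
      a + 0#                               ≈⟨ +-congˡ (trans (*-congˡ ρ≈0) (zeroʳ r)) ⟨
      a + r * remainder r (b ∷ f)          ≈⟨ ρ′≈0 ⟩
      0#                                   ∎

  Root : Poly → Carrier → Set ℓ
  Root f s = eval f s ≈ 0#

  roots-quotient : ∀ r f {rs} → Root f r → All (r ≉_) rs → All (Root f) rs → All (Root (quotient r f)) rs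
  roots-quotient r f         _   []             []              = []
  roots-quotient r f {s ∷ _} f[r]≈0 (r≉s ∷ r≉rs) (f[s]≈0 ∷ f[rs]≈0) =
    x*y≈0⇒y≈0 s-r≉0 s-r*q[s]≈0 ∷ roots-quotient r f f[r]≈0 r≉rs f[rs]≈0
    where
    s-r≉0 : s - r ≉ 0#
    s-r≉0 s-r≈0 = r≉s (sym (x∙y⁻¹≈ε⇒x≈y s r s-r≈0))
    s-r*q[s]≈0 : (s - r) * eval (quotient r f) s ≈ 0#
    s-r*q[s]≈0 = begin
      (s - r) * eval (quotient r f) s                   ≈⟨ +-identityʳ _ ⟨
      (s - r) * eval (quotient r f) s + 0#              ≈⟨ +-congˡ (trans (remainder≈eval r f) f[r]≈0) ⟨
      (s - r) * eval (quotient r f) s + remainder r f   ≈⟨ eval-quotient r f s ⟨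
      eval f s                                          ≈⟨ f[s]≈0 ⟩
      0#                                                ∎

  root-bound : ∀ rs f → AllPairs _≉_ rs → All (Root f) rs → length f ≤ length rs → IsZero f
  root-bound []       []      _               _             _         = []
  root-bound (r ∷ rs) []      _               _             _         = []
  root-bound (r ∷ rs) (a ∷ f) (r≉rs ∷ rs-distinct) (f[r]≈0 ∷ f[rs]≈0) (s≤s f≤rs) =
    IsZero-quotient⇒IsZero r (a ∷ f)
      (root-bound rs (quotient r (a ∷ f)) rs-distinct
         (roots-quotient r (a ∷ f) f[r]≈0 r≉rs f[rs]≈0)
         (≡.subst (_≤ length rs) (≡.sym (length-quotient r a f)) f≤rs))
      (trans (remainder≈eval r (a ∷ f)) f[r]≈0)

module Trace {c ℓ p m} (p-prime : Prime p) (F : FiniteField c ℓ (p ℕ.^ m)) where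

  open FiniteField F
  open FieldProperties F
  open Polynomial F
  open import Algebra.Properties.Ring ring using (+-cancelʳ; -‿distribʳ-*)
  open import Algebra.Properties.CommutativeSemigroup +-commutativeSemigroup using (interchange)
  open import Data.List.Relation.Unary.All using (All; _∷_)
  open import Data.List.Relation.Unary.AllPairs using (AllPairs; _∷_)
  import Data.List.Relation.Unary.All.Properties as Allₚ
  import Data.List.Relation.Unary.AllPairs.Properties as AllPairsₚ
  import Data.List.Properties as List
  open import Relation.Binary.Reasoning.Setoid setoid

  ι-p≈0 : ι F p ≈ 0#
  ι-p≈0 = ^≈0⇒≈0 m (trans (sym (ι-^ p m)) ι-q≈0)

  open Characteristic p-prime ι-p≈0 public

  Xᵖ-X : Poly
  Xᵖ-X = (0# ∷ - 1# ∷ []) +ₚ X^ p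

  Xᵖ-X-root : ∀ {z} → z ^ p ≈ z → Root Xᵖ-X z
  Xᵖ-X-root {z} zᵖ≈z = begin
    eval Xᵖ-X z                                   ≈⟨ eval-+ₚ (0# ∷ - 1# ∷ []) (X^ p) z ⟩
    (0# + z * (- 1# + z * 0#)) + eval (X^ p) z    ≈⟨ +-cong lower-terms≈-z (trans (eval-X^ p z) zᵖ≈z) ⟩
    - z + z                                       ≈⟨ -‿inverseˡ z ⟩
    0#                                            ∎
    where
    lower-terms≈-z : 0# + z * (- 1# + z * 0#) ≈ - z
    lower-terms≈-z = begin
      0# + z * (- 1# + z * 0#)   ≈⟨ +-identityˡ _ ⟩
      z * (- 1# + z * 0#)        ≈⟨ *-congˡ (trans (+-congˡ (zeroʳ z)) (+-identityʳ _)) ⟩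
      z * - 1#                   ≈⟨ -‿distribʳ-* z 1# ⟨
      - (z * 1#)                 ≈⟨ -‿cong (*-identityʳ z) ⟩
      - z                        ∎

  ^p≈id⇒∈𝔽ₚ : ∀ {y} → y ^ p ≈ y → ∃ λ (s : Fin p) → y ≈ ι F (toℕ s)
  ^p≈id⇒∈𝔽ₚ {y} yᵖ≈y with Fin.any? (λ (s : Fin p) → y ≟ ι F (toℕ s))
  ... | yes y∈𝔽ₚ = y∈𝔽ₚ
  ... | no  y∉𝔽ₚ = ⊥-elim (+ₚX^-nonzero (0# ∷ - 1# ∷ []) p 1<p
                      (root-bound rs Xᵖ-X distinct roots (ℕ.≤-reflexive length-Xᵖ-X≡length-rs)))
    where
    rs : List Carrier
    rs = y ∷ tabulate (ι F ∘ toℕ)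
    distinct : AllPairs _≉_ rs
    distinct = Allₚ.tabulate⁺ (λ s y≈s → y∉𝔽ₚ (s , y≈s))
             ∷ AllPairsₚ.tabulate⁺ (λ {i} {j} i≢j ιi≈ιj → i≢j (ι-injective i j ιi≈ιj))
    roots : All (Root Xᵖ-X) rs
    roots = Xᵖ-X-root yᵖ≈y ∷ Allₚ.tabulate⁺ (λ s → Xᵖ-X-root (ι^p≈ι (toℕ s)))
    length-Xᵖ-X≡length-rs : length Xᵖ-X ≡ length rs
    length-Xᵖ-X≡length-rs = ≡.trans (length-+ₚX^ (0# ∷ - 1# ∷ []) p 1<p)
                                     (≡.cong suc (≡.sym (List.length-tabulate (ι F ∘ toℕ))))

  trace-suc : ∀ k x → trace F p (suc k) x ≈ trace F p k x + x ^ (p ℕ.^ k)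
  trace-suc k x = +-congˡ (pow≈^ x (p ℕ.^ k))

  trace-cong : ∀ k {x y} → x ≈ y → trace F p k x ≈ trace F p k y
  trace-cong zero    _   = refl
  trace-cong (suc k) {x} {y} x≈y = begin
    trace F p (suc k) x                ≈⟨ trace-suc k x ⟩
    trace F p k x + x ^ (p ℕ.^ k)      ≈⟨ +-cong (trace-cong k x≈y) (^-congˡ (p ℕ.^ k) x≈y) ⟩
    trace F p k y + y ^ (p ℕ.^ k)      ≈⟨ trace-suc k y ⟨
    trace F p (suc k) y                ∎

  trace-+ : ∀ k x y → trace F p k (x + y) ≈ trace F p k x + trace F p k y
  trace-+ zero    x y = sym (+-identityʳ 0#)
  trace-+ (suc k) x y = begin
    trace F p (suc k) (x + y)                            ≈⟨ trace-suc k (x + y) ⟩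
    trace F p k (x + y) + (x + y) ^ (p ℕ.^ k)            ≈⟨ +-cong (trace-+ k x y) (frobenius-+ⁿ k x y) ⟩
    (trace F p k x + trace F p k y) + (x ^ (p ℕ.^ k) + y ^ (p ℕ.^ k))
                                                         ≈⟨ interchange _ _ _ _ ⟩
    (trace F p k x + x ^ (p ℕ.^ k)) + (trace F p k y + y ^ (p ℕ.^ k))
                                                         ≈⟨ +-cong (trace-suc k x) (trace-suc k y) ⟨
    trace F p (suc k) x + trace F p (suc k) y            ∎

  trace-* : ∀ {a} → a ^ p ≈ a → ∀ k x → trace F p k (a * x) ≈ a * trace F p k x
  trace-* {a} aᵖ≈a zero    x = sym (zeroʳ a)
  trace-* {a} aᵖ≈a (suc k) x = begin
    trace F p (suc k) (a * x)                        ≈⟨ trace-suc k (a * x) ⟩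
    trace F p k (a * x) + (a * x) ^ (p ℕ.^ k)        ≈⟨ +-cong (trace-* aᵖ≈a k x) (^-distrib-* a x (p ℕ.^ k)) ⟩
    a * trace F p k x + a ^ (p ℕ.^ k) * x ^ (p ℕ.^ k)  ≈⟨ +-congˡ (*-congʳ (^p≈id⇒^pⁿ≈id aᵖ≈a k)) ⟩
    a * trace F p k x + a * x ^ (p ℕ.^ k)            ≈⟨ distribˡ a _ _ ⟨
    a * (trace F p k x + x ^ (p ℕ.^ k))              ≈⟨ *-congˡ (trace-suc k x) ⟨
    a * trace F p (suc k) x                          ∎

  trace^p+x : ∀ k x → trace F p k x ^ p + x ≈ trace F p k x + x ^ (p ℕ.^ k)
  trace^p+x zero    x = trans (+-congʳ 0^p≈0) (+-congˡ (sym (*-identityʳ x)))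
  trace^p+x (suc k) x = begin
    trace F p (suc k) x ^ p + x                       ≈⟨ +-congʳ (^-congˡ p (trace-suc k x)) ⟩
    (t + xᵖᵏ) ^ p + x                                 ≈⟨ +-congʳ (frobenius-+ p-prime ι-p≈0 t xᵖᵏ) ⟩
    (t ^ p + xᵖᵏ ^ p) + x                             ≈⟨ +-assoc _ _ x ⟩
    t ^ p + (xᵖᵏ ^ p + x)                             ≈⟨ +-congˡ (+-comm _ x) ⟩
    t ^ p + (x + xᵖᵏ ^ p)                             ≈⟨ +-assoc _ x _ ⟨
    (t ^ p + x) + xᵖᵏ ^ p                             ≈⟨ +-cong (trace^p+x k x) xᵖᵏ^p≈ ⟩
    (t + xᵖᵏ) + x ^ (p ℕ.^ suc k)                     ≈⟨ +-congʳ (trace-suc k x) ⟨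
    trace F p (suc k) x + x ^ (p ℕ.^ suc k)           ∎
    where
    t = trace F p k x
    xᵖᵏ = x ^ (p ℕ.^ k)
    xᵖᵏ^p≈ : xᵖᵏ ^ p ≈ x ^ (p ℕ.^ suc k)
    xᵖᵏ^p≈ = trans (^-assocʳ x (p ℕ.^ k) p) (^-congʳ x (ℕ.*-comm (p ℕ.^ k) p))

  trace^p≈trace : ∀ x → trace F p m x ^ p ≈ trace F p m x
  trace^p≈trace x = +-cancelʳ x _ _ (trans (trace^p+x m x) (+-congˡ (^q≈id x)))

  trace∈𝔽ₚ : ∀ x → ∃ λ (s : Fin p) → trace F p m x ≈ ι F (toℕ s)
  trace∈𝔽ₚ x = ^p≈id⇒∈𝔽ₚ (trace^p≈trace x)

  tracePoly : ℕ → Poly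
  tracePoly zero    = []
  tracePoly (suc k) = tracePoly k +ₚ X^ (p ℕ.^ k)

  eval-tracePoly : ∀ k x → eval (tracePoly k) x ≈ trace F p k x
  eval-tracePoly zero    x = refl
  eval-tracePoly (suc k) x = begin
    eval (tracePoly k +ₚ X^ (p ℕ.^ k)) x               ≈⟨ eval-+ₚ (tracePoly k) (X^ (p ℕ.^ k)) x ⟩
    eval (tracePoly k) x + eval (X^ (p ℕ.^ k)) x       ≈⟨ +-cong (eval-tracePoly k x) (eval-X^ (p ℕ.^ k) x) ⟩
    trace F p k x + x ^ (p ℕ.^ k)                      ≈⟨ trace-suc k x ⟨
    trace F p (suc k) x                                ∎

  length-tracePoly : ∀ k → length (tracePoly k) ≤ p ℕ.^ k
  length-tracePoly zero    = z≤n
  length-tracePoly (suc k) = ≡.subst (_≤ p ℕ.^ suc k)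
    (≡.sym (length-+ₚX^ (tracePoly k) (p ℕ.^ k) (length-tracePoly k)))
    (ℕ.^-monoʳ-< p 1<p (ℕ.n<1+n k))

  tracePoly-nonzero : ∀ k → 1 ≤ k → ¬ IsZero (tracePoly k)
  tracePoly-nonzero (suc k) _ = +ₚX^-nonzero (tracePoly k) (p ℕ.^ k) (length-tracePoly k)

  trace-nonzero : 1 ≤ m → ∃ λ x → trace F p m x ≉ 0#
  trace-nonzero 1≤m
    with Fin.¬∀⟶∃¬ (p ℕ.^ m) (λ i → trace F p m (enum i) ≈ 0#) (λ i → trace F p m (enum i) ≟ 0#) trace≉0
    where
    trace≉0 : ¬ (∀ i → trace F p m (enum i) ≈ 0#)
    trace≉0 trace≈0 = tracePoly-nonzero m 1≤m (root-bound (tabulate enum) (tracePoly m)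
      (AllPairsₚ.tabulate⁺ (λ {i} {j} i≢j eᵢ≈eⱼ → i≢j (enum-inj i j eᵢ≈eⱼ)))
      (Allₚ.tabulate⁺ (λ i → trans (eval-tracePoly m (enum i)) (trace≈0 i)))
      (≡.subst (length (tracePoly m) ≤_) (≡.sym (List.length-tabulate enum)) (length-tracePoly m)))
  ... | i , trace≉0 = enum i , trace≉0

module TraceTable {c ℓ p n} (p-prime : Prime p) (F : FiniteField c ℓ (p ℕ.^ suc n)) where

  open FiniteField F
  open FieldProperties F
  open Trace {m = suc n} p-prime F
  open import Algebra.Properties.Ring ring using (+-identityˡ-unique)
  open import Data.Product using (_×_)

  private instance
    p-nonZero = prime⇒nonZero p-prime

  tr : Carrier → Carrier
  tr = trace F p (suc n)

  tr-cong : ∀ {x y} → x ≈ y → tr x ≈ tr y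
  tr-cong = trace-cong (suc n)

  tr-* : ∀ {a} → a ^ p ≈ a → ∀ x → tr (a * x) ≈ a * tr x
  tr-* aᵖ≈a = trace-* aᵖ≈a (suc n)

  ∃tr≈1 : ∃ λ x → tr x ≈ 1#
  ∃tr≈1 with trace-nonzero (s≤s z≤n)
  ... | x , w≉0 = w ⁻¹ * x , trans (tr-* w⁻¹ᵖ≈w⁻¹ x) (inverseˡ w≉0)
    where
    w = tr x
    w⁻¹ᵖ≈w⁻¹ : w ⁻¹ ^ p ≈ w ⁻¹
    w⁻¹ᵖ≈w⁻¹ = trans (⁻¹-^ p w≉0) (⁻¹-cong (^-nonzero p w≉0) (trace^p≈trace x))

  ∑𝟙-≈ι : ∀ {y} (s₀ : Fin p) → y ≈ ι F (toℕ s₀) → ∑[ s < p ] 𝟙 (y ≟ ι F (toℕ s)) ≡ 1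
  ∑𝟙-≈ι {y} s₀ y≈s₀ = ∑𝟙-unique (λ s → y ≟ ι F (toℕ s)) y≈s₀
    (λ s y≈s → ι-injective s s₀ (trans (sym y≈s) y≈s₀))

  ∑𝟙-tr≈ι : ∀ x → ∑[ s < p ] 𝟙 (tr x ≟ ι F (toℕ s)) ≡ 1
  ∑𝟙-tr≈ι x = ∑𝟙-≈ι (proj₁ (trace∈𝔽ₚ x)) (proj₂ (trace∈𝔽ₚ x))

  fibre≡fibre₀ : ∀ s → count (λ x → tr x ≟ ι F s) ≡ count (λ x → tr x ≟ 0#)
  fibre≡fibre₀ s = count-permute (λ x → tr x ≟ ι F s) (λ x → tr x ≟ 0#) (translation z)
    (λ x≈y tr-x≈s → trans (tr-cong (sym x≈y)) tr-x≈s)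
    (λ x tr[x+z]≈s → +-identityˡ-unique (tr x) (ι F s) (trans (sym (tr-x+z x)) tr[x+z]≈s))
    (λ x tr-x≈0 → trans (tr-x+z x) (trans (+-congʳ tr-x≈0) (+-identityˡ _)))
    where
    z = ι F s * proj₁ ∃tr≈1
    tr-x+z : ∀ x → tr (x + z) ≈ tr x + ι F s
    tr-x+z x = trans (trace-+ (suc n) x z)
      (+-congˡ (trans (tr-* (ι^p≈ι s) _) (trans (*-congˡ (proj₂ ∃tr≈1)) (*-identityʳ _))))

  fibre-size : ∀ s → count (λ x → tr x ≟ ι F s) ≡ p ℕ.^ n
  fibre-size s = ≡.trans (fibre≡fibre₀ s) (ℕ.*-cancelˡ-≡ _ _ p (begin
    p ℕ.* K                                               ≡⟨ ∑-const p K ⟨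
    ∑[ s < p ] K                                          ≡⟨ sum-cong-≗ {p} (λ s → fibre≡fibre₀ (toℕ s)) ⟨
    ∑[ s < p ] count (λ x → tr x ≟ ι F (toℕ s))           ≡⟨ ∑-comm {p} {p ℕ.^ suc n} (λ s i → 𝟙 (tr (enum i) ≟ ι F (toℕ s))) ⟩
    ∑[ i < p ℕ.^ suc n ] ∑[ s < p ] 𝟙 (tr (enum i) ≟ ι F (toℕ s))  ≡⟨ sum-cong-≗ (∑𝟙-tr≈ι ∘ enum) ⟩
    ∑[ i < p ℕ.^ suc n ] 1                                ≡⟨ ∑-const (p ℕ.^ suc n) 1 ⟩
    p ℕ.^ suc n ℕ.* 1                                     ≡⟨ ℕ.*-identityʳ _ ⟩
    p ℕ.* p ℕ.^ n                                         ∎))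
    where
    K = count (λ x → tr x ≟ 0#)
    open ≡.≡-Reasoning

  tr-zero : ∀ {x} → x ≈ 0# → tr x ≈ 0#
  tr-zero x≈0 = trans (tr-cong (trans x≈0 (sym (zeroˡ 0#)))) (trans (tr-* 0^p≈0 0#) (zeroˡ _))

  Entry : ℕ → ℕ → Pred Carrier ℓ
  Entry i j x = x ≉ 0# × tr x ≈ ι F i × tr (x ⁻¹) ≈ ι F j

  entry? : ∀ i j → U.Decidable (Entry i j)
  entry? i j x = ¬? (x ≟ 0#) ×-dec (tr x ≟ ι F i) ×-dec (tr (x ⁻¹) ≟ ι F j)

  Entry-resp : ∀ i j → Entry i j Respects _≈_
  Entry-resp i j x≈y (x≉0 , tr-x≈i , tr-x⁻¹≈j) =
    y≉0 , trans (tr-cong (sym x≈y)) tr-x≈i , trans (tr-cong (⁻¹-cong y≉0 (sym x≈y))) tr-x⁻¹≈j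
    where y≉0 = x≉0 ∘ trans x≈y

  T≡count : ∀ i j → T F p (suc n) i j ≡ count (entry? i j)
  T≡count i j = length-filter-tabulate (entry? i j ∘ enum) {p ℕ.^ suc n} (λ k → k)

  ∑-row : ∀ i x → ∑[ s < p ] 𝟙 (entry? i (toℕ s) x) ≡ 𝟙 (¬? (x ≟ 0#) ×-dec (tr x ≟ ι F i))
  ∑-row i x with ¬? (x ≟ 0#) ×-dec (tr x ≟ ι F i)
  ... | yes (x≉0 , tr-x≈i) = ≡.trans
    (sum-cong-≗ {p} λ s → 𝟙-cong (proj₂ ∘ proj₂) (λ tr-x⁻¹≈s → x≉0 , tr-x≈i , tr-x⁻¹≈s)
                                (entry? i (toℕ s) x) (tr (x ⁻¹) ≟ ι F (toℕ s)))
    (∑𝟙-tr≈ι (x ⁻¹))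
  ... | no ¬[x≉0×tr-x≈i] = ∑𝟙-none {p} (λ s → entry? i (toℕ s) x)
    (λ s (x≉0 , tr-x≈i , _) → ¬[x≉0×tr-x≈i] (x≉0 , tr-x≈i))

  row-sum : ∀ i → ∑[ s < p ] count (entry? i (toℕ s)) ≡ count (λ x → ¬? (x ≟ 0#) ×-dec (tr x ≟ ι F i))
  row-sum i = ≡.trans (∑-comm {p} {p ℕ.^ suc n} (λ s k → 𝟙 (entry? i (toℕ s) (enum k))))
                      (sum-cong-≗ (∑-row i ∘ enum))

  row₁ : ∑[ s < p ] count (entry? 1 (toℕ s)) ≡ p ℕ.^ n
  row₁ = ≡.trans (row-sum 1) (≡.trans
    (sum-cong-≗ λ k → 𝟙-¬× (enum k ≟ 0#) (tr (enum k) ≟ ι F 1)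
                        (λ x≈0 tr-x≈1 → ι-nonzero (s≤s z≤n) 1<p (trans (sym tr-x≈1) (tr-zero x≈0))))
    (fibre-size 1))

  row₀ : ∑[ s < p ] count (entry? 0 (toℕ s)) ℕ.+ 1 ≡ p ℕ.^ n
  row₀ = begin
    ∑[ s < p ] count (entry? 0 (toℕ s)) ℕ.+ 1
      ≡⟨ ≡.cong₂ ℕ._+_ (row-sum 0) (≡.sym (count-≈ 0#)) ⟩
    count (λ x → ¬? (x ≟ 0#) ×-dec (tr x ≟ 0#)) ℕ.+ count (_≟ 0#)
      ≡⟨ ∑-distrib-+ (λ k → 𝟙 (¬? (enum k ≟ 0#) ×-dec (tr (enum k) ≟ 0#))) (λ k → 𝟙 (enum k ≟ 0#)) ⟨
    ∑[ k < p ℕ.^ suc n ] (𝟙 (¬? (enum k ≟ 0#) ×-dec (tr (enum k) ≟ 0#)) ℕ.+ 𝟙 (enum k ≟ 0#))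
      ≡⟨ sum-cong-≗ (λ k → 𝟙-¬×+𝟙 (enum k ≟ 0#) (tr (enum k) ≟ 0#) tr-zero) ⟩
    count (λ x → tr x ≟ 0#)
      ≡⟨ fibre-size 0 ⟩
    p ℕ.^ n ∎
    where open ≡.≡-Reasoning

  module ScaledInversion {a} (a≉0 : a ≉ 0#) (aᵖ≈a : a ^ p ≈ a) where

    a⁻¹≉0 : a ⁻¹ ≉ 0#
    a⁻¹≉0 = ⁻¹-nonzero a≉0

    σ : Permutation
    σ = scaling a⁻¹≉0 ∘ₚ inversion

    σ≈0 : ∀ {x} → x ≈ 0# → to σ x ≈ 0#
    σ≈0 x≈0 = trans (*-congˡ (inv₀-zero x≈0)) (zeroʳ _)

    σ≈a⁻¹*x⁻¹ : ∀ {x} → x ≉ 0# → to σ x ≈ a ⁻¹ * x ⁻¹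
    σ≈a⁻¹*x⁻¹ x≉0 = *-congˡ (inv₀-nonzero x≉0)

    σ≉0 : ∀ {x} → x ≉ 0# → to σ x ≉ 0#
    σ≉0 x≉0 σx≈0 = *-nonzero a⁻¹≉0 (⁻¹-nonzero x≉0) (trans (sym (σ≈a⁻¹*x⁻¹ x≉0)) σx≈0)

    σ⁻¹ : ∀ {x} → x ≉ 0# → (to σ x) ⁻¹ ≈ a * x
    σ⁻¹ {x} x≉0 = trans (⁻¹-cong (σ≉0 x≉0) (σ≈a⁻¹*x⁻¹ x≉0)) (trans
      (⁻¹-distrib-* a⁻¹≉0 (⁻¹-nonzero x≉0)) (*-cong (⁻¹-involutive a≉0) (⁻¹-involutive x≉0)))

    tr-σ : ∀ {x} → x ≉ 0# → tr (to σ x) ≈ a ⁻¹ * tr (x ⁻¹)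
    tr-σ {x} x≉0 = trans (tr-cong (σ≈a⁻¹*x⁻¹ x≉0)) (tr-* a⁻¹ᵖ≈a⁻¹ (x ⁻¹))
      where a⁻¹ᵖ≈a⁻¹ = trans (⁻¹-^ p a≉0) (⁻¹-cong (^-nonzero p a≉0) aᵖ≈a)

    tr-σ⁻¹ : ∀ {x} → x ≉ 0# → tr ((to σ x) ⁻¹) ≈ a * tr x
    tr-σ⁻¹ {x} x≉0 = trans (tr-cong (σ⁻¹ x≉0)) (tr-* aᵖ≈a x)

  count-entry₀ₛ≡count-entry₁₀ : ∀ {s} → 0 < s → s < p → count (entry? 0 s) ≡ count (entry? 1 0)
  count-entry₀ₛ≡count-entry₁₀ {s} 0<s s<p = ≡.sym (count-permute (entry? 1 0) (entry? 0 s) σ (Entry-resp 1 0) fwd bwd)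
    where
    c≉0 = ι-nonzero 0<s s<p
    open ScaledInversion c≉0 (ι^p≈ι s)
    fwd : ∀ x → Entry 1 0 (to σ x) → Entry 0 s x
    fwd x (σx≉0 , tr-σx≈1 , tr-σx⁻¹≈0) = x≉0 , tr-x≈0 , tr-x⁻¹≈s
      where
      x≉0 : x ≉ 0#
      x≉0 = σx≉0 ∘ σ≈0
      tr-x≈0 : tr x ≈ 0#
      tr-x≈0 = x*y≈0⇒y≈0 c≉0 (trans (sym (tr-σ⁻¹ x≉0)) tr-σx⁻¹≈0)
      tr-x⁻¹≈s : tr (x ⁻¹) ≈ ι F s
      tr-x⁻¹≈s = trans (⁻¹-unique a⁻¹≉0 (trans (sym (tr-σ x≉0)) (trans tr-σx≈1 (+-identityʳ 1#))))
                       (⁻¹-involutive c≉0)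
    bwd : ∀ x → Entry 0 s x → Entry 1 0 (to σ x)
    bwd x (x≉0 , tr-x≈0 , tr-x⁻¹≈s) = σ≉0 x≉0 , tr-σx≈1 , tr-σx⁻¹≈0
      where
      tr-σx≈1 : tr (to σ x) ≈ ι F 1
      tr-σx≈1 = trans (tr-σ x≉0) (trans (*-congˡ tr-x⁻¹≈s) (trans (inverseˡ c≉0) (sym (+-identityʳ 1#))))
      tr-σx⁻¹≈0 : tr ((to σ x) ⁻¹) ≈ 0#
      tr-σx⁻¹≈0 = trans (tr-σ⁻¹ x≉0) (trans (*-congˡ tr-x≈0) (zeroʳ _))

module TraceTableRows {c ℓ k n} (p-prime : Prime (suc (suc k))) (F : FiniteField c ℓ (suc (suc k) ℕ.^ suc n)) where

  open TraceTable {n = n} p-prime F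
  open FieldProperties F using (count)
  import Data.List.Properties as List
  open ≡.≡-Reasoning

  p = suc (suc k)

  S≡∑ : sum (map (T F p (suc n) 1) (map suc (upTo (suc k)))) ≡ ∑[ s < suc k ] count (entry? 1 (suc (toℕ s)))
  S≡∑ = begin
    sum (map (T F p (suc n) 1) (map suc (upTo (suc k))))   ≡⟨ ≡.cong (sum ∘ map _) (List.map-upTo suc (suc k)) ⟩
    sum (map (T F p (suc n) 1) (applyUpTo suc (suc k)))    ≡⟨ ≡.cong sum (List.map-applyUpTo suc _ (suc k)) ⟩
    sum (applyUpTo (T F p (suc n) 1 ∘ suc) (suc k))        ≡⟨ sum-applyUpTo (T F p (suc n) 1 ∘ suc) (suc k) ⟩
    ∑[ s < suc k ] T F p (suc n) 1 (suc (toℕ s))           ≡⟨ sum-cong-≗ {suc k} (λ s → T≡count 1 (suc (toℕ s))) ⟩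
    ∑[ s < suc k ] count (entry? 1 (suc (toℕ s)))          ∎

  -- ∑[ s < p ] unfolds to its s = 0 term plus the sum over s = suc _, as p = suc (suc k).
  T-row₁ : T F p (suc n) 1 0 ℕ.+ sum (map (T F p (suc n) 1) (map suc (upTo (suc k)))) ≡ p ℕ.^ n
  T-row₁ = ≡.trans (≡.cong₂ ℕ._+_ (T≡count 1 0) S≡∑) row₁

  T-row₀ : T F p (suc n) 0 0 ℕ.+ suc k ℕ.* T F p (suc n) 1 0 ℕ.+ 1 ≡ p ℕ.^ n
  T-row₀ = begin
    T F p (suc n) 0 0 ℕ.+ suc k ℕ.* T F p (suc n) 1 0 ℕ.+ 1
      ≡⟨ ≡.cong₂ (λ a b → a ℕ.+ suc k ℕ.* b ℕ.+ 1) (T≡count 0 0) (T≡count 1 0) ⟩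
    count (entry? 0 0) ℕ.+ suc k ℕ.* count (entry? 1 0) ℕ.+ 1
      ≡⟨ ≡.cong (λ z → count (entry? 0 0) ℕ.+ z ℕ.+ 1) (∑-const (suc k) _) ⟨
    count (entry? 0 0) ℕ.+ ∑[ s < suc k ] count (entry? 1 0) ℕ.+ 1
      ≡⟨ ≡.cong (λ z → count (entry? 0 0) ℕ.+ z ℕ.+ 1) (sum-cong-≗ {suc k} entry₀ₛ≡entry₁₀) ⟨
    count (entry? 0 0) ℕ.+ ∑[ s < suc k ] count (entry? 0 (suc (toℕ s))) ℕ.+ 1
      ≡⟨ row₀ ⟩
    p ℕ.^ n                                                ∎
    where
    entry₀ₛ≡entry₁₀ : ∀ s → count (entry? 0 (suc (toℕ s))) ≡ count (entry? 1 0)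
    entry₀ₛ≡entry₁₀ s = count-entry₀ₛ≡count-entry₁₀ (s≤s z≤n) (s≤s (Fin.toℕ<n s))

open import Data.Nat using (_^_)
open import Data.Integer using (ℤ; +_; _+_; _-_; _*_)
import Data.Integer.Properties as ℤ
import Data.Integer.Tactic.RingSolver as ℤ-Solver
open import Data.Product using (_×_)

eliminate-b : ∀ (a b u S r : ℤ) → a + u * b + + 1 ≡ r → b + S ≡ r →
              a ≡ ((u * S + + 2 * r) - (+ 1 + u) * r) - + 1
eliminate-b a b u S r eq₀ eq₁ = begin
  a                                                 ≡⟨ regroup a b u S ⟩
  ((a + u * b + + 1) - u * (b + S)) + u * S - + 1   ≡⟨ ≡.cong₂ (λ x y → (x - u * y) + u * S - + 1) eq₀ eq₁ ⟩
  (r - u * r) + u * S - + 1                         ≡⟨ regroup′ r u S ⟩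
  ((u * S + + 2 * r) - (+ 1 + u) * r) - + 1         ∎
  where
  open ≡.≡-Reasoning
  regroup : ∀ a b u S → a ≡ ((a + u * b + + 1) - u * (b + S)) + u * S - + 1
  regroup = ℤ-Solver.solve-∀
  regroup′ : ∀ r u S → (r - u * r) + u * S - + 1 ≡ ((u * S + + 2 * r) - (+ 1 + u) * r) - + 1
  regroup′ = ℤ-Solver.solve-∀

row₁⇒ℤ : ∀ {b S r} → b ℕ.+ S ≡ r → + b ≡ + r - + S
row₁⇒ℤ {b} {S} ≡.refl = cancel (+ b) (+ S)
  where
  cancel : ∀ x y → x ≡ (x + y) - y
  cancel = ℤ-Solver.solve-∀

rows⇒ℤ : ∀ {a b u S r} → a ℕ.+ u ℕ.* b ℕ.+ 1 ≡ r → b ℕ.+ S ≡ r →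
         + a ≡ ((+ u * + S + + 2 * + r) - + (suc u ℕ.* r)) - + 1
rows⇒ℤ {a} {b} {u} {S} {r} eq₀ eq₁ = ≡.trans
  (eliminate-b (+ a) (+ b) (+ u) (+ S) (+ r)
     (≡.trans (≡.cong (λ z → + a + z + + 1) (≡.sym (ℤ.pos-* u b))) (≡.cong +_ eq₀)) (≡.cong +_ eq₁))
  (≡.cong (λ z → ((+ u * + S + + 2 * + r) - z) - + 1) (≡.sym (ℤ.pos-* (suc u) r)))

lemma2 : ∀ {c ℓ : Level} (p m : ℕ) → Prime p → m ≥ 1 →
    (F : FiniteField c ℓ (p ^ m)) →
    let q = p ^ m
        S = sum (map (λ s → T F p m 1 s) (map suc (upTo (p ∸ 1))))
    in ((+ T F p m 1 0) ≡ (+ (p ^ (m ∸ 1))) - (+ S))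
       × ((+ T F p m 0 0)
         ≡ (((+ (p ∸ 1)) * (+ S) + (+ 2) * (+ (p ^ (m ∸ 1)))) - (+ q)) - (+ 1))
lemma2 zero          m       p-prime = ⊥-elim (¬prime[0] p-prime)
lemma2 (suc zero)    m       p-prime = ⊥-elim (¬prime[1] p-prime)
lemma2 (suc (suc k)) (suc n) p-prime _ F = row₁⇒ℤ T-row₁ , rows⇒ℤ {u = suc k} T-row₀ T-row₁
  where open TraceTableRows {n = n} p-prime F
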